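{- Let $m\ge 2$ be an odd integer and let $n=2m^2$. Let $\Gamma$ be a strongly regular $n$-bicirculant with parameters $(4m^2,\,2m^2-m,\,m^2-m,\,m^2-m)$ which, for some $(2,n)$-semiregular automorphism $\rho$ and vertices $u,w$ in its two distinct orbits, has symbol $[S,S',T]$ with $|T|=m^2$ and $|S|=|S'|=m^2-m$. Then $\Gamma$ is not locally $3$-isoregular at any vertex.
   Context: All graphs are finite and simple. A strongly regular graph with parameters $(N,k,\lambda,\mu)$ is a $k$-regular graph on $N$ vertices in which adjacent vertices have exactly $\lambda$ common neighbours and distinct non-adjacent vertices have exactly $\mu$ common neighbours. An $n$-bicirculant is a graph on $2n$ vertices admitting a $(2,n)$-semiregular automorphism $\rho$, i.e. an automorphism whose cycle decomposition consists of exactly two cycles (orbits) $U,W$ of length $n$. For $u\in U$, $w\in W$, the symbol of $\Gamma$ relative to $(\rho,u,w)$ is $[S,S',T]$ where $S=\{s\in\mathbb{Z}_n\setminus\{0\}: u\sim\rho^s(u)\}$, $S'=\{r\in\mathbb{Z}_n\setminus\{0\}: w\sim\rho^r(w)\}$ and $T=\{t\in\mathbb{Z}_n: u\sim\rho^t(w)\}$. For a vertex set $X$, the valency of $X$ is the number of vertices adjacent to every vertex of $X$. An ordered pair $(x,y)$ of distinct vertices is $3$-isoregular if for all vertices $z\ne x,y$ the valency of $\{x,y,z\}$ depends only on the isomorphism type of the subgraph induced on $\{x,y,z\}$. A graph is locally $3$-isoregular at a vertex $x$ if there exist a neighbour $y$ of $x$ and a non-neighbour $z\neq x$ of $x$ such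 that both $(x,y)$ and $(x,z)$ are $3$-isoregular. -}

module Defs where

open import Data.Nat using (ℕ; zero; suc; _+_; _*_; _≡ᵇ_)
open import Data.Bool using (Bool; true; false; _∧_; not; if_then_else_)
open import Data.Fin using (Fin; toℕ) renaming (zero to fzero; suc to fsuc)
open import Data.Product using (Σ; ∃; _×_; _,_)
open import Relation.Binary.PropositionalEquality using (_≡_; _≢_)
open import Function.Bundles using (_↔_; Inverse)

record Graph (N : ℕ) : Set where
  field
    adj   : Fin N → Fin N → Bool
    sym   : ∀ x y → adj x y ≡ adj y x
    irrefl : ∀ x → adj x x ≡ false
open Graph public

count : ∀ {n} → (Fin n → Bool) → ℕ
count {zero}  p = 0
count {suc n} p = (if p fzero then 1 else 0) + count (λ i → p (fsuc i))

module _ {N : ℕ} (G : Graph N) where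

  degree : Fin N → ℕ
  degree x = count (λ v → adj G x v)

  common : Fin N → Fin N → ℕ
  common x y = count (λ v → adj G x v ∧ adj G y v)

  StronglyRegular : ℕ → ℕ → ℕ → Set
  StronglyRegular k l μ =
    (∀ x → degree x ≡ k)
    × (∀ x y → adj G x y ≡ true → common x y ≡ l)
    × (∀ x y → x ≢ y → adj G x y ≡ false → common x y ≡ μ)

  valency3 : Fin N → Fin N → Fin N → ℕ
  valency3 x y z = count (λ v → adj G v x ∧ adj G v y ∧ adj G v z)

  triple : Fin N → Fin N → Fin N → Fin 3 → Fin N
  triple x y z fzero = x
  triple x y z (fsuc fzero) = y
  triple x y z (fsuc (fsuc fzero)) = z

  InducedIso : (Fin 3 → Fin N) → (Fin 3 → Fin N) → Set
  InducedIso t t' = Σ (Fin 3 ↔ Fin 3) λ σ →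
    ∀ i j → adj G (t i) (t j) ≡ adj G (t' (Inverse.to σ i)) (t' (Inverse.to σ j))

  ThreeIsoregular : Fin N → Fin N → Set
  ThreeIsoregular x y =
    x ≢ y ×
    (∀ z z' → z ≢ x → z ≢ y → z' ≢ x → z' ≢ y →
       InducedIso (triple x y z) (triple x y z') →
       valency3 x y z ≡ valency3 x y z')

  LocallyThreeIsoregular : Fin N → Set
  LocallyThreeIsoregular x =
    Σ (Fin N) λ y → Σ (Fin N) λ z →
      adj G x y ≡ true × z ≢ x × adj G x z ≡ false ×
      ThreeIsoregular x y × ThreeIsoregular x z

iter : ∀ {A : Set} → (A → A) → ℕ → A → A
iter f zero x = x
iter f (suc k) x = f (iter f k x)

module _ {N : ℕ} (G : Graph N) where

  IsAutomorphism : (Fin N ↔ Fin N) → Set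
  IsAutomorphism ρ = ∀ x y → adj G (Inverse.to ρ x) (Inverse.to ρ y) ≡ adj G x y

-- ρ is (2,n)-semiregular on Fin (2 * n): every cycle of ρ has length exactly n
-- (so there are exactly two cycles, each of length n)
Semiregular : ∀ {N} → (Fin N → Fin N) → ℕ → Set
Semiregular {N} f n =
  ∀ v → iter f n v ≡ v × (∀ i → 0 Data.Nat.< i → i Data.Nat.< n → iter f i v ≢ v)

module _ {n : ℕ} (G : Graph (2 * n)) (ρ : Fin (2 * n) → Fin (2 * n)) where

  sizeS : Fin (2 * n) → ℕ
  sizeS u = count {n} (λ s → not (toℕ s ≡ᵇ 0) ∧ adj G u (iter ρ (toℕ s) u))

  sizeT : Fin (2 * n) → Fin (2 * n) → ℕ
  sizeT u w = count {n} (λ t → adj G u (iter ρ (toℕ t) w))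

{-# OPTIONS --safe #-}
module Submission where

-- Let z be a non-neighbour of x with (x, z) 3-isoregular, and let c v be the number of common
-- neighbours of x, z and v.  By 3-isoregularity c is constant on the common neighbours of x and z
-- (value a), on the neighbours of x only (value b), and on the vertices other than x, z adjacent to
-- neither (value d).  Counting the pairs (w, v) with w a common neighbour of x and z and v ∼ w,
-- once for v ∼ x and once for all v, gives, with λ = μ = m (m - 1) and k = m (2m - 1),
--   λ² = a λ + b m²   and   k λ + a λ = 2 λ² + 2 λ + d (m - 1) (m + 2).
-- Since m - 1 ≡ -1 modulo m, the first forces a = a′ m with a′ ≤ m - 1; the second then reduces to
-- m² (1 + a′) = 2 m + d (m + 2), so the odd number m + 2 divides 4 (a′ + 2), hence a′ + 2, although
-- 0 < a′ + 2 < m + 2.  Only the strongly regular parameters and the pair (x, z) are used.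

open import Defs hiding (sym)
open import Data.Nat using (ℕ; zero; suc; _+_; _*_; _∸_; _≤_; _<_; _%_; _/_; NonZero; s≤s; z≤n)
open import Data.Nat.Properties
  using (+-*-semiring; +-identityʳ; *-identityʳ; *-zeroʳ; +-comm; *-assoc; *-suc; suc-injective;
         +-cancelˡ-≡; *-cancelˡ-≡; *-cancelʳ-≤; m*n≢0; m≤m+n; m+n∸m≡n; module ≤-Reasoning)
open import Data.Nat.DivMod using (m≡m%n+[m/n]*n; [m+n]%n≡m%n)
open import Data.Nat.Divisibility using (_∣_; divides; ∣m+n∣m⇒∣n; ∣m⇒∣m*n; m∣m*n; n∣m*n; >⇒∤)
open import Data.Nat.Tactic.RingSolver using (solve-∀)
open import Data.Bool using (Bool; true; false; _∧_; not; if_then_else_)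
open import Data.Bool.Properties
  using (∧-assoc; ∧-identityʳ; ∧-commutativeMonoid; ∧-conicalˡ; ∧-conicalʳ; not-involutive)
  renaming (_≟_ to _≟ᵇ_)
open import Data.Fin using (Fin; zero; suc; _≟_)
open import Data.Fin.Properties using (any?)
open import Data.Product using (∃; _×_; _,_; proj₁; proj₂)
open import Data.Empty using (⊥; ⊥-elim)
open import Function.Bundles using (_↔_; Inverse)
open import Function.Construct.Identity using (↔-id)
open import Relation.Binary.PropositionalEquality
  using (_≡_; _≢_; refl; sym; trans; cong; cong₂; subst; subst₂; module ≡-Reasoning)
open import Relation.Nullary using (¬_; does; yes; no)
open import Relation.Nullary.Decidable using (dec-true; dec-false)
open import Algebra.Bundles using (CommutativeMonoid)
open import Algebra.Properties.Semiring.Sum +-*-semiring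
  using (sum; sum-cong-≗; sum-replicate-zero; ∑-distrib-+; ∑-comm; *-distribˡ-sum)
open import Algebra.Properties.CommutativeSemigroup (CommutativeMonoid.commutativeSemigroup ∧-commutativeMonoid)
  using () renaming (x∙yz≈y∙xz to ∧-left-comm)

private variable
  n n′ : ℕ

sumWhere : (Fin n → Bool) → (Fin n → ℕ) → ℕ
sumWhere p f = sum (λ i → if p i then f i else 0)

count≡sumWhere : (p : Fin n → Bool) → count p ≡ sumWhere p (λ _ → 1)
count≡sumWhere {zero}  p = refl
count≡sumWhere {suc n} p = cong ((if p zero then 1 else 0) +_) (count≡sumWhere (λ i → p (suc i)))

count-cong : {p q : Fin n → Bool} → (∀ i → p i ≡ q i) → count p ≡ count q
count-cong {zero}  eq = refl
count-cong {suc n} eq = cong₂ (λ b c → (if b then 1 else 0) + c) (eq zero) (count-cong (λ i → eq (suc i)))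

count-false : count {n} (λ _ → false) ≡ 0
count-false {zero}  = refl
count-false {suc n} = count-false {n}

count-true : count {n} (λ _ → true) ≡ n
count-true {zero}  = refl
count-true {suc n} = cong suc (count-true {n})

sumWhere-cong : {p : Fin n → Bool} {f g : Fin n → ℕ} →
                (∀ i → p i ≡ true → f i ≡ g i) → sumWhere p f ≡ sumWhere p g
sumWhere-cong {p = p} {f} {g} eq = sum-cong-≗ pointwise
  where
  pointwise : ∀ i → (if p i then f i else 0) ≡ (if p i then g i else 0)
  pointwise i with p i in pi
  ... | true  = eq i pi
  ... | false = refl

sumWhere-constant : {p : Fin n → Bool} {f : Fin n → ℕ} (K : ℕ) →
                    (∀ i → p i ≡ true → f i ≡ K) → sumWhere p f ≡ K * count p
sumWhere-constant {n} {p} {f} K f≡K = begin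
  sumWhere p f                               ≡⟨ sumWhere-cong f≡K ⟩
  sum (λ i → if p i then K else 0)           ≡⟨ sum-cong-≗ scale ⟩
  sum (λ i → K * (if p i then 1 else 0))     ≡⟨ *-distribˡ-sum K (λ i → if p i then 1 else 0) ⟨
  K * sumWhere p (λ _ → 1)                   ≡⟨ cong (K *_) (count≡sumWhere p) ⟨
  K * count p                                ∎
  where
  open ≡-Reasoning
  scale : ∀ i → (if p i then K else 0) ≡ K * (if p i then 1 else 0)
  scale i with p i
  ... | true  = sym (*-identityʳ K)
  ... | false = sym (*-zeroʳ K)

sumWhere-uniform : {p : Fin n → Bool} {f : Fin n → ℕ} →
                   (∀ i j → p i ≡ true → p j ≡ true → f i ≡ f j) →
                   ∃ λ K → sumWhere p f ≡ K * count p
sumWhere-uniform {p = p} {f} uniform with any? (λ i → p i ≟ᵇ true)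
... | yes (j , pj) = f j , sumWhere-constant (f j) (λ i pi → uniform i j pi pj)
... | no  none     = 0 , sumWhere-constant 0 (λ i pi → ⊥-elim (none (i , pi)))

sumWhere-split : (p q : Fin n → Bool) (f : Fin n → ℕ) →
                 sumWhere p f ≡ sumWhere (λ i → p i ∧ q i) f + sumWhere (λ i → p i ∧ not (q i)) f
sumWhere-split {n} p q f = trans (sum-cong-≗ pointwise) (∑-distrib-+ {n} _ _)
  where
  pointwise : ∀ i → (if p i then f i else 0)
                  ≡ (if p i ∧ q i then f i else 0) + (if p i ∧ not (q i) then f i else 0)
  pointwise i with p i | q i
  ... | true  | true  = sym (+-identityʳ (f i))
  ... | true  | false = refl
  ... | false | _     = refl

sum-inclusion-exclusion :
  (p q : Fin n → Bool) (f : Fin n → ℕ) →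
  sum f + sumWhere (λ i → p i ∧ q i) f
    ≡ sumWhere p f + sumWhere q f + sumWhere (λ i → not (p i) ∧ not (q i)) f
sum-inclusion-exclusion {n} p q f = begin
  sum f + sumWhere (λ i → p i ∧ q i) f      ≡⟨ ∑-distrib-+ {n} f _ ⟨
  sum (λ i → f i + part (p i ∧ q i) i)      ≡⟨ sum-cong-≗ pointwise ⟩
  sum (λ i → part (p i) i + part (q i) i + part (not (p i) ∧ not (q i)) i)
                                            ≡⟨ ∑-distrib-+ {n} _ _ ⟩
  sum (λ i → part (p i) i + part (q i) i) + sumWhere neither f
                                            ≡⟨ cong (_+ sumWhere neither f) (∑-distrib-+ {n} _ _) ⟩
  sumWhere p f + sumWhere q f + sumWhere neither f ∎
  where
  open ≡-Reasoning
  neither : Fin n → Bool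
  neither i = not (p i) ∧ not (q i)
  part : Bool → Fin n → ℕ
  part b i = if b then f i else 0
  pointwise : ∀ i → f i + part (p i ∧ q i) i ≡ part (p i) i + part (q i) i + part (not (p i) ∧ not (q i)) i
  pointwise i with p i | q i
  ... | true  | true  = sym (+-identityʳ _)
  ... | true  | false = sym (+-identityʳ _)
  ... | false | true  = refl
  ... | false | false = +-identityʳ (f i)

sumWhere-≟ : (f : Fin n → ℕ) (j : Fin n) → sumWhere (λ i → does (i ≟ j)) f ≡ f j
sumWhere-≟ {suc n} f zero    = trans (cong (f zero +_) (sum-replicate-zero n)) (+-identityʳ (f zero))
sumWhere-≟ {suc n} f (suc j) = sumWhere-≟ (λ i → f (suc i)) j

sumWhere-remove : {p : Fin n → Bool} (f : Fin n → ℕ) {j : Fin n} → p j ≡ true →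
                  sumWhere p f ≡ f j + sumWhere (λ i → p i ∧ not (does (i ≟ j))) f
sumWhere-remove {n} {p} f {j} pj = begin
  sumWhere p f                                                 ≡⟨ sum-cong-≗ pointwise ⟩
  sum (λ i → (if does (i ≟ j) then f i else 0) + (if rest i then f i else 0))
                                                               ≡⟨ ∑-distrib-+ {n} _ _ ⟩
  sumWhere (λ i → does (i ≟ j)) f + sumWhere rest f            ≡⟨ cong (_+ sumWhere rest f) (sumWhere-≟ f j) ⟩
  f j + sumWhere rest f                                        ∎
  where
  open ≡-Reasoning
  rest : Fin n → Bool
  rest i = p i ∧ not (does (i ≟ j))
  pointwise : ∀ i → (if p i then f i else 0)
                  ≡ (if does (i ≟ j) then f i else 0) + (if p i ∧ not (does (i ≟ j)) then f i else 0)
  pointwise i with i ≟ j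
  ... | yes refl rewrite pj = sym (+-identityʳ (f i))
  ... | no  _    rewrite ∧-identityʳ (p i) = refl

count-comm : (R : Fin n → Fin n′ → Bool) →
             sum (λ i → count (R i)) ≡ sum (λ j → count (λ i → R i j))
count-comm {n} {n′} R = begin
  sum (λ i → count (R i))                        ≡⟨ sum-cong-≗ (λ i → count≡sumWhere (R i)) ⟩
  sum (λ i → sumWhere (R i) (λ _ → 1))           ≡⟨ ∑-comm {n} {n′} (λ i j → if R i j then 1 else 0) ⟩
  sum (λ j → sumWhere (λ i → R i j) (λ _ → 1))   ≡⟨ sum-cong-≗ (λ j → count≡sumWhere (λ i → R i j)) ⟨
  sum (λ j → count (λ i → R i j))                ∎
  where open ≡-Reasoning

sumWhere-count : (p : Fin n → Bool) (R : Fin n → Fin n′ → Bool) →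
                 sumWhere p (λ i → count (R i)) ≡ sum (λ i → count (λ j → p i ∧ R i j))
sumWhere-count {n′ = n′} p R = sum-cong-≗ pointwise
  where
  pointwise : ∀ i → (if p i then count (R i) else 0) ≡ count (λ j → p i ∧ R i j)
  pointwise i with p i
  ... | true  = refl
  ... | false = sym (count-false {n′})

double-counting : (p : Fin n → Bool) (q : Fin n′ → Bool) (R : Fin n′ → Fin n → Bool) →
                  sumWhere p (λ i → count (λ j → q j ∧ R j i))
                    ≡ sumWhere q (λ j → count (λ i → p i ∧ R j i))
double-counting p q R = begin
  sumWhere p (λ i → count (λ j → q j ∧ R j i))     ≡⟨ sumWhere-count p (λ i j → q j ∧ R j i) ⟩
  sum (λ i → count (λ j → p i ∧ (q j ∧ R j i)))
    ≡⟨ sum-cong-≗ (λ i → count-cong (λ j → ∧-left-comm (p i) (q j) (R j i))) ⟩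
  sum (λ i → count (λ j → q j ∧ (p i ∧ R j i)))    ≡⟨ count-comm (λ i j → q j ∧ (p i ∧ R j i)) ⟩
  sum (λ j → count (λ i → q j ∧ (p i ∧ R j i)))    ≡⟨ sumWhere-count q (λ j i → p i ∧ R j i) ⟨
  sumWhere q (λ j → count (λ i → p i ∧ R j i))     ∎
  where open ≡-Reasoning

∧-true⁻ : ∀ {a b} → a ∧ b ≡ true → a ≡ true × b ≡ true
∧-true⁻ {a} {b} e = ∧-conicalˡ a b e , ∧-conicalʳ a b e

not-true⁻ : ∀ {a} → not a ≡ true → a ≡ false
not-true⁻ {a} e = trans (sym (not-involutive a)) (cong not e)

does-false⇒≢ : ∀ {n} {i j : Fin n} → does (i ≟ j) ≡ false → i ≢ j
does-false⇒≢ {i = i} {j} e i≡j with () ← trans (sym (dec-true (i ≟ j) i≡j)) e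

module _ {N : ℕ} (G : Graph N) where

  adj⇒≢ : ∀ {x v} → adj G x v ≡ true → v ≢ x
  adj⇒≢ {x} x∼x refl with () ← trans (sym x∼x) (Graph.irrefl G x)

  isoregular-valency-congruent :
    ∀ {x y v v′} → ThreeIsoregular G x y →
    v ≢ x → v ≢ y → v′ ≢ x → v′ ≢ y →
    adj G x v ≡ adj G x v′ → adj G y v ≡ adj G y v′ →
    valency3 G x y v ≡ valency3 G x y v′
  isoregular-valency-congruent {x} {y} {v} {v′} (_ , iso) v≢x v≢y v′≢x v′≢y xv yv =
    iso v v′ v≢x v≢y v′≢x v′≢y (↔-id _ , preserves)
    where
    preserves : ∀ i j → adj G (triple G x y v i) (triple G x y v j)
                      ≡ adj G (triple G x y v′ i) (triple G x y v′ j)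
    preserves zero             zero             = refl
    preserves zero             (suc zero)       = refl
    preserves zero             (suc (suc zero)) = xv
    preserves (suc zero)       zero             = refl
    preserves (suc zero)       (suc zero)       = refl
    preserves (suc zero)       (suc (suc zero)) = yv
    preserves (suc (suc zero)) zero             = trans (Graph.sym G v x) (trans xv (Graph.sym G x v′))
    preserves (suc (suc zero)) (suc zero)       = trans (Graph.sym G v y) (trans yv (Graph.sym G y v′))
    preserves (suc (suc zero)) (suc (suc zero)) = trans (Graph.irrefl G v) (sym (Graph.irrefl G v′))

module NonadjacentPair {N : ℕ} (G : Graph N) {k l μ : ℕ} (srg : StronglyRegular G k l μ)
                       {x z : Fin N} (x≢z : x ≢ z) (x≁z : adj G x z ≡ false) where

  both x-only neither outside : Fin N → Bool
  both    v = adj G x v ∧ adj G z v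
  x-only   v = adj G x v ∧ not (adj G z v)
  neither v = not (adj G x v) ∧ not (adj G z v)
  outside v = (neither v ∧ not (does (v ≟ x))) ∧ not (does (v ≟ z))

  one : Fin N → ℕ
  one _ = 1

  count-both : count both ≡ μ
  count-both = proj₂ (proj₂ srg) x z x≢z x≁z

  neighbourhood-split : (f : Fin N → ℕ) → sumWhere (adj G x) f ≡ sumWhere both f + sumWhere x-only f
  neighbourhood-split = sumWhere-split (adj G x) (adj G z)

  vertex-split : (f : Fin N → ℕ) →
                 sum f + sumWhere both f
                   ≡ sumWhere (adj G x) f + sumWhere (adj G z) f + (f x + (f z + sumWhere outside f))
  vertex-split f = trans (sum-inclusion-exclusion (adj G x) (adj G z) f)
                         (cong (sumWhere (adj G x) f + sumWhere (adj G z) f +_) neither-split)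
    where
    neither-x : neither x ≡ true
    neither-x rewrite Graph.irrefl G x | Graph.sym G z x | x≁z = refl
    neither-z : neither z ∧ not (does (z ≟ x)) ≡ true
    neither-z rewrite x≁z | Graph.irrefl G z | dec-false (z ≟ x) (λ z≡x → x≢z (sym z≡x)) = refl
    neither-split : sumWhere neither f ≡ f x + (f z + sumWhere outside f)
    neither-split = trans (sumWhere-remove f neither-x) (cong (f x +_) (sumWhere-remove f neither-z))

  sumWhere-adj-one : ∀ y → sumWhere (adj G y) one ≡ k
  sumWhere-adj-one y = trans (sym (count≡sumWhere (adj G y))) (proj₁ srg y)

  degree-split : k ≡ μ + count x-only
  degree-split = begin
    k                                         ≡⟨ sumWhere-adj-one x ⟨
    sumWhere (adj G x) one                    ≡⟨ neighbourhood-split one ⟩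
    sumWhere both one + sumWhere x-only one   ≡⟨ cong₂ _+_ (count≡sumWhere both) (count≡sumWhere x-only) ⟨
    count both + count x-only                 ≡⟨ cong (_+ count x-only) count-both ⟩
    μ + count x-only                          ∎
    where open ≡-Reasoning

  vertex-count : N + μ ≡ k + k + (1 + (1 + count outside))
  vertex-count = begin
    N + μ                                     ≡⟨ cong₂ _+_ (count-true {N}) count-both ⟨
    count {N} (λ _ → true) + count both       ≡⟨ cong₂ _+_ (count≡sumWhere {N} (λ _ → true))
                                                           (count≡sumWhere both) ⟩
    sum one + sumWhere both one               ≡⟨ vertex-split one ⟩
    sumWhere (adj G x) one + sumWhere (adj G z) one + (1 + (1 + sumWhere outside one))
      ≡⟨ cong₂ _+_ (cong₂ _+_ (sumWhere-adj-one x) (sumWhere-adj-one z))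
                   (cong (λ c → 1 + (1 + c)) (sym (count≡sumWhere outside))) ⟩
    k + k + (1 + (1 + count outside))         ∎
    where open ≡-Reasoning

  valency : Fin N → ℕ
  valency = valency3 G x z

  valency≡count : ∀ v → valency v ≡ count (λ w → both w ∧ adj G w v)
  valency≡count v = count-cong λ w →
    trans (cong₂ (λ a b → a ∧ b ∧ adj G w v) (Graph.sym G w x) (Graph.sym G w z))
          (sym (∧-assoc (adj G x w) (adj G z w) (adj G w v)))

  sumWhere-valency : (q : Fin N → Bool) (K : ℕ) →
                     (∀ w → both w ≡ true → count (λ v → q v ∧ adj G w v) ≡ K) →
                     sumWhere q valency ≡ K * μ
  sumWhere-valency q K constant = begin
    sumWhere q valency                                    ≡⟨ sumWhere-cong (λ v _ → valency≡count v) ⟩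
    sumWhere q (λ v → count (λ w → both w ∧ adj G w v))   ≡⟨ double-counting q both (adj G) ⟩
    sumWhere both (λ w → count (λ v → q v ∧ adj G w v))   ≡⟨ sumWhere-constant K constant ⟩
    K * count both                                        ≡⟨ cong (K *_) count-both ⟩
    K * μ                                                 ∎
    where open ≡-Reasoning

  x∼both : ∀ w → both w ≡ true → adj G x w ≡ true
  x∼both w e = proj₁ (∧-true⁻ e)

  z∼both : ∀ w → both w ≡ true → adj G z w ≡ true
  z∼both w e = proj₂ (∧-true⁻ e)

  sum-valency : sum valency ≡ k * μ
  sum-valency = sumWhere-valency (λ _ → true) k (λ w _ → proj₁ srg w)

  sumWhere-adj-valency : ∀ {y} → (∀ w → both w ≡ true → adj G y w ≡ true) →
                         sumWhere (adj G y) valency ≡ l * μ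
  sumWhere-adj-valency {y} y∼both =
    sumWhere-valency (adj G y) l (λ w w∈both → proj₁ (proj₂ srg) y w (y∼both w w∈both))

  valency-endpoint : ∀ {y} → (∀ w → both w ≡ true → adj G y w ≡ true) → valency y ≡ μ
  valency-endpoint {y} y∼both = trans (valency≡count y) (trans (count-cong absorb) count-both)
    where
    absorb : ∀ w → both w ∧ adj G w y ≡ both w
    absorb w with both w in w∈both
    ... | true  = trans (Graph.sym G w y) (y∼both w w∈both)
    ... | false = refl

  HasType : Bool → Bool → Fin N → Set
  HasType i j v = v ≢ x × v ≢ z × adj G x v ≡ i × adj G z v ≡ j

  x∼⇒≢z : ∀ {v} → adj G x v ≡ true → v ≢ z
  x∼⇒≢z x∼v refl with () ← trans (sym x∼v) x≁z

  both-type : ∀ v → both v ≡ true → HasType true true v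
  both-type v v∈both = adj⇒≢ G x∼v , adj⇒≢ G z∼v , x∼v , z∼v
    where
    x∼v : adj G x v ≡ true
    x∼v = x∼both v v∈both
    z∼v : adj G z v ≡ true
    z∼v = z∼both v v∈both

  x-only-type : ∀ v → x-only v ≡ true → HasType true false v
  x-only-type v v∈x-only = adj⇒≢ G x∼v , x∼⇒≢z x∼v , x∼v , not-true⁻ z≁v
    where
    x∼v : adj G x v ≡ true
    x∼v = proj₁ (∧-true⁻ v∈x-only)
    z≁v : not (adj G z v) ≡ true
    z≁v = proj₂ (∧-true⁻ v∈x-only)

  outside-type : ∀ v → outside v ≡ true → HasType false false v
  outside-type v v∈outside =
    does-false⇒≢ (not-true⁻ v≠x) , does-false⇒≢ (not-true⁻ v≠z) , not-true⁻ x≁v , not-true⁻ z≁v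
    where
    v∈neither∖x : neither v ∧ not (does (v ≟ x)) ≡ true
    v∈neither∖x = proj₁ (∧-true⁻ v∈outside)
    v≠z : not (does (v ≟ z)) ≡ true
    v≠z = proj₂ (∧-true⁻ v∈outside)
    v≠x : not (does (v ≟ x)) ≡ true
    v≠x = proj₂ (∧-true⁻ v∈neither∖x)
    v∈neither : neither v ≡ true
    v∈neither = proj₁ (∧-true⁻ v∈neither∖x)
    x≁v : not (adj G x v) ≡ true
    x≁v = proj₁ (∧-true⁻ v∈neither)
    z≁v : not (adj G z v) ≡ true
    z≁v = proj₂ (∧-true⁻ v∈neither)

  isoregular-uniform : ThreeIsoregular G x z → ∀ {p i j} → (∀ v → p v ≡ true → HasType i j v) →
                       ∃ λ K → sumWhere p valency ≡ K * count p
  isoregular-uniform iso {p} typed = sumWhere-uniform congruent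
    where
    congruent : ∀ v v′ → p v ≡ true → p v′ ≡ true → valency v ≡ valency v′
    congruent v v′ pv pv′ with typed v pv | typed v′ pv′
    ... | v≢x , v≢z , xv , zv | v′≢x , v′≢z , xv′ , zv′ =
      isoregular-valency-congruent G iso v≢x v≢z v′≢x v′≢z (trans xv (sym xv′)) (trans zv (sym zv′))

  isoregular-equations :
    ThreeIsoregular G x z →
    ∃ λ a → ∃ λ b → ∃ λ d →
      l * μ ≡ a * μ + b * count x-only ×
      k * μ + a * μ ≡ l * μ + l * μ + (μ + (μ + d * count outside))
  isoregular-equations iso
    with isoregular-uniform iso both-type | isoregular-uniform iso x-only-type | isoregular-uniform iso outside-type
  ... | a , on-both | b , on-x-only | d , on-outside = a , b , d , neighbourhood-equation , vertex-equation
    where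
    open ≡-Reasoning
    on-both′ : sumWhere both valency ≡ a * μ
    on-both′ = trans on-both (cong (a *_) count-both)

    neighbourhood-equation : l * μ ≡ a * μ + b * count x-only
    neighbourhood-equation = begin
      l * μ                                           ≡⟨ sumWhere-adj-valency x∼both ⟨
      sumWhere (adj G x) valency                      ≡⟨ neighbourhood-split valency ⟩
      sumWhere both valency + sumWhere x-only valency  ≡⟨ cong₂ _+_ on-both′ on-x-only ⟩
      a * μ + b * count x-only                         ∎

    vertex-equation : k * μ + a * μ ≡ l * μ + l * μ + (μ + (μ + d * count outside))
    vertex-equation = begin
      k * μ + a * μ                                   ≡⟨ cong₂ _+_ sum-valency on-both′ ⟨
      sum valency + sumWhere both valency             ≡⟨ vertex-split valency ⟩
      sumWhere (adj G x) valency + sumWhere (adj G z) valency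
        + (valency x + (valency z + sumWhere outside valency))
        ≡⟨ cong₂ _+_ (cong₂ _+_ (sumWhere-adj-valency x∼both) (sumWhere-adj-valency z∼both))
                     (cong₂ _+_ (valency-endpoint x∼both)
                                (cong₂ _+_ (valency-endpoint z∼both) on-outside)) ⟩
      l * μ + l * μ + (μ + (μ + d * count outside))   ∎

-- For n = 1 + 2 q, the number 1 + q inverts 2 modulo n.
odd∣double⇒∣ : ∀ {n c} → n % 2 ≡ 1 → n ∣ 2 * c → n ∣ c
odd∣double⇒∣ {n} {c} n-odd n∣2c =
  ∣m+n∣m⇒∣n (subst (n ∣_) expand (∣m⇒∣m*n (1 + q) n∣2c)) (n∣m*n c)
  where
  q : ℕ
  q = n / 2
  n≡ : n ≡ 1 + q * 2
  n≡ = trans (m≡m%n+[m/n]*n n 2) (cong (_+ q * 2) n-odd)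
  identity : ∀ c q → 2 * c * (1 + q) ≡ c * (1 + q * 2) + c
  identity = solve-∀
  expand : 2 * c * (1 + q) ≡ c * n + c
  expand = trans (identity c q) (cong (λ n → c * n + c) (sym n≡))

-- Modulo m + 2 we have m ≡ -2, so the hypothesis reads 4 (1 + a) ≡ -4.
m+2∣4[a+2] : ∀ m a d → m * m * (1 + a) ≡ 2 * m + d * (m + 2) → m + 2 ∣ 2 * (2 * (2 + a))
m+2∣4[a+2] m a d eq = ∣m+n∣m⇒∣n (divides (d + 2 * (2 + a)) multiple) (m∣m*n (m * (1 + a)))
  where
  open ≡-Reasoning
  expand : ∀ m a → (m + 2) * (m * (1 + a)) + 2 * (2 * (2 + a))
                   ≡ m * m * (1 + a) + (2 * m * (1 + a) + 4 * (2 + a))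
  expand = solve-∀
  collect : ∀ m a d → 2 * m + d * (m + 2) + (2 * m * (1 + a) + 4 * (2 + a))
                      ≡ (d + 2 * (2 + a)) * (m + 2)
  collect = solve-∀
  multiple : (m + 2) * (m * (1 + a)) + 2 * (2 * (2 + a)) ≡ (d + 2 * (2 + a)) * (m + 2)
  multiple = begin
    (m + 2) * (m * (1 + a)) + 2 * (2 * (2 + a))            ≡⟨ expand m a ⟩
    m * m * (1 + a) + (2 * m * (1 + a) + 4 * (2 + a))      ≡⟨ cong (_+ (2 * m * (1 + a) + 4 * (2 + a))) eq ⟩
    2 * m + d * (m + 2) + (2 * m * (1 + a) + 4 * (2 + a))  ≡⟨ collect m a d ⟩
    (d + 2 * (2 + a)) * (m + 2)                            ∎

-- Here m = suc t, so that λ = μ = m² ∸ m and k = 2 m² ∸ m become m * t and m * (m + t).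
module _ (t : ℕ) where

  x-only-count≡ : ∀ {nB} → let m = suc t in m * (m + t) ≡ m * t + nB → nB ≡ m * m
  x-only-count≡ {nB} eq = +-cancelˡ-≡ (suc t * t) nB (suc t * suc t) (trans (sym eq) (identity t))
    where
    identity : ∀ t → let m = suc t in m * (m + t) ≡ m * t + m * m
    identity = solve-∀

  outside-count≡ : ∀ {nD} → let m = suc t ; k = m * (m + t) in
                   2 * (2 * (m * m)) + m * t ≡ k + k + (1 + (1 + nD)) → nD ≡ t * (m + 2)
  outside-count≡ {nD} eq =
    suc-injective (suc-injective (+-cancelˡ-≡ (k + k) _ _ (trans (sym eq) (identity t))))
    where
    k : ℕ
    k = suc t * (suc t + t)
    identity : ∀ t → let m = suc t ; k = m * (m + t) in
               2 * (2 * (m * m)) + m * t ≡ k + k + (1 + (1 + t * (m + 2)))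
    identity = solve-∀

  module _ .{{_ : NonZero t}} where

    divided-neighbourhood-equation : ∀ {a b} → let m = suc t ; L = m * t in
      L * L ≡ a * L + b * (m * m) → m * (t * t) ≡ a * t + b * m
    divided-neighbourhood-equation {a} {b} eq =
      *-cancelˡ-≡ _ _ (suc t) (trans (expand t) (trans eq (factor t a b)))
      where
      expand : ∀ t → let m = suc t in m * (m * (t * t)) ≡ (m * t) * (m * t)
      expand = solve-∀
      factor : ∀ t a b → let m = suc t in a * (m * t) + b * (m * m) ≡ m * (a * t + b * m)
      factor = solve-∀

    m∣neighbourhood-coefficient : ∀ {a b} → let m = suc t ; L = m * t in
      L * L ≡ a * L + b * (m * m) → m ∣ a
    m∣neighbourhood-coefficient {a} {b} eq =
      ∣m+n∣m⇒∣n (divides (a + b) (trans (cong (_+ a) reduced) (regroup t a b))) (m∣m*n (t * t))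
      where
      reduced : suc t * (t * t) ≡ a * t + b * suc t
      reduced = divided-neighbourhood-equation {a} {b} eq
      regroup : ∀ t a b → let m = suc t in a * t + b * m + a ≡ (a + b) * m
      regroup = solve-∀

    neighbourhood-coefficient : ∀ {a b} → let m = suc t ; L = m * t in
      L * L ≡ a * L + b * (m * m) → ∃ λ a′ → a ≡ a′ * m × a′ ≤ t
    neighbourhood-coefficient {a} {b} eq with m∣neighbourhood-coefficient {a} {b} eq
    ... | divides a′ refl = a′ , refl , *-cancelʳ-≤ a′ t (m * t) {{m*n≢0 m t}} bound
      where
      open ≤-Reasoning
      m : ℕ
      m = suc t
      swap : ∀ t → let m = suc t in m * (t * t) ≡ t * (m * t)
      swap = solve-∀
      bound : a′ * (m * t) ≤ t * (m * t)
      bound = begin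
        a′ * (m * t)              ≡⟨ *-assoc a′ m t ⟨
        a′ * m * t                ≤⟨ m≤m+n (a′ * m * t) (b * m) ⟩
        a′ * m * t + b * m        ≡⟨ divided-neighbourhood-equation {a′ * m} {b} eq ⟨
        m * (t * t)               ≡⟨ swap t ⟩
        t * (m * t)               ∎

    divided-vertex-equation : ∀ {a′ d} → let m = suc t ; L = m * t ; k = m * (m + t) in
      k * L + a′ * m * L ≡ L * L + L * L + (L + (L + d * (t * (m + 2)))) →
      m * m * (1 + a′) ≡ 2 * m + d * (m + 2)
    divided-vertex-equation {a′} {d} eq =
      +-cancelˡ-≡ (2 * (m * m * t)) _ _ (*-cancelˡ-≡ _ _ t (trans (lhs t a′) (trans eq (rhs t d))))
      where
      m : ℕ
      m = suc t
      lhs : ∀ t a′ → let m = suc t ; L = m * t ; k = m * (m + t) in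
            t * (2 * (m * m * t) + m * m * (1 + a′)) ≡ k * L + a′ * m * L
      lhs = solve-∀
      rhs : ∀ t d → let m = suc t ; L = m * t in
            L * L + L * L + (L + (L + d * (t * (m + 2)))) ≡ t * (2 * (m * m * t) + (2 * m + d * (m + 2)))
      rhs = solve-∀

    no-parameter-solution :
      suc t % 2 ≡ 1 → ∀ {nB nD a b d} → let m = suc t ; L = m * t ; k = m * (m + t) in
      k ≡ L + nB → 2 * (2 * (m * m)) + L ≡ k + k + (1 + (1 + nD)) →
      L * L ≡ a * L + b * nB → k * L + a * L ≡ L * L + L * L + (L + (L + d * nD)) → ⊥
    no-parameter-solution m-odd {a = a} {b} {d} degree vertices neighbourhood-eq vertex-eq
      with x-only-count≡ degree | outside-count≡ vertices
    ... | refl | refl with neighbourhood-coefficient {a} {b} neighbourhood-eq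
    ... | a′ , refl , a′≤t = >⇒∤ 2+a′<m+2 m+2∣2+a′
      where
      m : ℕ
      m = suc t
      m+2-odd : (m + 2) % 2 ≡ 1
      m+2-odd = trans ([m+n]%n≡m%n m 2) m-odd
      2+a′<m+2 : 2 + a′ < m + 2
      2+a′<m+2 = subst (2 + a′ <_) (+-comm 2 m) (s≤s (s≤s (s≤s a′≤t)))
      m+2∣2+a′ : m + 2 ∣ 2 + a′
      m+2∣2+a′ = odd∣double⇒∣ m+2-odd (odd∣double⇒∣ m+2-odd
                   (m+2∣4[a+2] m a′ d (divided-vertex-equation {a′} {d} vertex-eq)))

[1+t]²∸[1+t]≡[1+t]*t : ∀ t → suc t * suc t ∸ suc t ≡ suc t * t
[1+t]²∸[1+t]≡[1+t]*t t = trans (cong (_∸ suc t) (*-suc (suc t) t)) (m+n∸m≡n (suc t) (suc t * t))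

2[1+t]²∸[1+t]≡[1+t]*[1+t+t] : ∀ t → 2 * (suc t * suc t) ∸ suc t ≡ suc t * (suc t + t)
2[1+t]²∸[1+t]≡[1+t]*[1+t+t] t =
  trans (cong (_∸ suc t) (identity t)) (m+n∸m≡n (suc t) (suc t * (suc t + t)))
  where
  identity : ∀ t → 2 * (suc t * suc t) ≡ suc t + suc t * (suc t + t)
  identity = solve-∀

nonadjacent-pair-not-isoregular :
  ∀ t .{{_ : NonZero t}} → suc t % 2 ≡ 1 →
  (G : Graph (2 * (2 * (suc t * suc t)))) →
  StronglyRegular G (suc t * (suc t + t)) (suc t * t) (suc t * t) →
  ∀ {x z} → x ≢ z → adj G x z ≡ false → ¬ ThreeIsoregular G x z
nonadjacent-pair-not-isoregular t m-odd G srg x≢z x≁z isoregular =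
  let (a , b , d , neighbourhood-eq , vertex-eq) = isoregular-equations isoregular
  in no-parameter-solution t m-odd {a = a} {b} {d} degree-split vertex-count neighbourhood-eq vertex-eq
  where open NonadjacentPair G srg x≢z x≁z

proposition5p2 : (m : ℕ) → 2 ≤ m → m % 2 ≡ 1 →
    (G : Graph (2 * (2 * (m * m)))) →
    StronglyRegular G (2 * (m * m) ∸ m) (m * m ∸ m) (m * m ∸ m) →
    (ρ : Fin (2 * (2 * (m * m))) ↔ Fin (2 * (2 * (m * m)))) →
    IsAutomorphism G ρ →
    Semiregular (Inverse.to ρ) (2 * (m * m)) →
    (u w : Fin (2 * (2 * (m * m)))) →
    (∀ i → iter (Inverse.to ρ) i u ≢ w) →
    sizeT {2 * (m * m)} G (Inverse.to ρ) u w ≡ m * m →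
    sizeS {2 * (m * m)} G (Inverse.to ρ) u ≡ m * m ∸ m →
    sizeS {2 * (m * m)} G (Inverse.to ρ) w ≡ m * m ∸ m →
    ∀ x → ¬ LocallyThreeIsoregular G x
proposition5p2 (suc (suc t)) (s≤s (s≤s z≤n)) m-odd G srg _ _ _ _ _ _ _ _ _ x
               (_ , z , _ , z≢x , x≁z , _ , isoregular) =
  nonadjacent-pair-not-isoregular (suc t) m-odd G srg′ (λ x≡z → z≢x (sym x≡z)) x≁z isoregular
  where
  srg′ : StronglyRegular G (suc (suc t) * (suc (suc t) + suc t)) (suc (suc t) * suc t) (suc (suc t) * suc t)
  srg′ = subst₂ (λ k l → StronglyRegular G k l l)
                (2[1+t]²∸[1+t]≡[1+t]*[1+t+t] (suc t)) ([1+t]²∸[1+t]≡[1+t]*t (suc t)) srg
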